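{- Let $\mathbb{F}_{16}\supset\mathbb{F}_4$, let $V=\mathbb{F}_{16}^2$ regarded as a $4$-dimensional vector space over $\mathbb{F}_4$, and let $\Pi=PG(V)\cong PG(3,4)$. Let $\hat{S}$ be the set of $17$ lines of $\Pi$ given by the $1$-dimensional $\mathbb{F}_{16}$-subspaces of $V$ (a regular spread of $\Pi$), let $s\in\hat S$ be the line given by $\{(0,y): y\in\mathbb{F}_{16}\}$, and let $S=\hat S\setminus\{s\}$. Let $A$ be the set of $240$ lines of $\Pi$ that are not in $\hat S$ and are disjoint from $s$. Let $G$ be the group of $\mathbb{F}_{16}$-linear maps $V\to V$ of the form $(x,y)\mapsto(ax,\,cx+by)$ with $a,b\in\mathbb{F}_{16}$, $a^5=b^5=1$, $c\in\mathbb{F}_{16}$ (a group of order $400$, acting faithfully on $\Pi$); it preserves $\hat S$, $s$ and $A$, and it has exactly three orbits on $A$, each of size $80$. Then for any orbit $A_1$ of $G$ on $A$, the set $\mathcal{O}'=S\cup A_1$ of $96$ lines of $\Pi$ is a hyperoval of the line Grassmannian $\mathcal{L}$ of $\Pi$; that is, for every point $p$ and plane $P$ of $\Pi$ with $p\in P$, the number of lines of $\mathcal{O}'$ that contain $p$ and lie in $P$ is either $0$ or $2$.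
   Context: The line Grassmannian $\mathcal{L}$ of $\Pi=PG(3,4)$ is the partial linear space whose points are the lines of $\Pi$ and whose lines are the pencils $(p,P)$: for a point $p$ and a plane $P$ of $\Pi$ with $p\in P$, the pencil $(p,P)$ is the set of the $5$ lines of $\Pi$ through $p$ contained in $P$. A hyperoval of a partial linear space is a set of points meeting every line in either $0$ or $2$ points; thus a hyperoval of $\mathcal{L}$ is a set of lines of $\Pi$ meeting every pencil in $0$ or $2$ lines. A line of $\Pi$ is a $2$-dimensional $\mathbb{F}_4$-subspace of $V$, and $\mathbb{F}_{16}$-linear maps of $V$ are in particular $\mathbb{F}_4$-linear, hence act on the lines of $\Pi$. -}

module Defs where

open import Data.Bool using (Bool; true; false; _xor_; _∧_)
open import Data.Nat using (ℕ; zero; suc)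
open import Data.Product using (Σ; ∃; ∃-syntax; _×_; _,_; proj₁; proj₂)
open import Data.Sum using (_⊎_)
open import Data.Empty using (⊥)
open import Relation.Nullary using (¬_)
open import Relation.Binary.PropositionalEquality using (_≡_)
open import Function.Bundles using (_⇔_)

-- The field F16 = F2[t]/(t^4 + t + 1).
-- An element c0 + c1 t + c2 t^2 + c3 t^3 is stored by its coefficients.

record F16 : Set where
  constructor mk
  field
    c0 c1 c2 c3 : Bool

open F16 public

zeroF : F16
zeroF = mk false false false false

oneF : F16
oneF = mk true false false false

infixl 6 _+F_
infixl 7 _*F_

_+F_ : F16 → F16 → F16
mk a0 a1 a2 a3 +F mk b0 b1 b2 b3 = mk (a0 xor b0) (a1 xor b1) (a2 xor b2) (a3 xor b3)

-- polynomial product, reduced using t^4 = t + 1, t^5 = t^2 + t, t^6 = t^3 + t^2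
_*F_ : F16 → F16 → F16
mk a0 a1 a2 a3 *F mk b0 b1 b2 b3 =
  mk (d0 xor d4) (d1 xor d4 xor d5) (d2 xor d5 xor d6) (d3 xor d6)
  where
  d0 = a0 ∧ b0
  d1 = (a0 ∧ b1) xor (a1 ∧ b0)
  d2 = (a0 ∧ b2) xor (a1 ∧ b1) xor (a2 ∧ b0)
  d3 = (a0 ∧ b3) xor (a1 ∧ b2) xor (a2 ∧ b1) xor (a3 ∧ b0)
  d4 = (a1 ∧ b3) xor (a2 ∧ b2) xor (a3 ∧ b1)
  d5 = (a2 ∧ b3) xor (a3 ∧ b2)
  d6 = a3 ∧ b3

_^F_ : F16 → ℕ → F16
x ^F zero = oneF
x ^F suc n = x *F (x ^F n)

IsF4 : F16 → Set
IsF4 x = x ^F 4 ≡ x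

V : Set
V = F16 × F16

zeroV : V
zeroV = zeroF , zeroF

infixl 6 _+V_
infixr 7 _·_

_+V_ : V → V → V
(x , y) +V (x' , y') = (x +F x') , (y +F y')

_·_ : F16 → V → V
λ' · (x , y) = (λ' *F x) , (λ' *F y)

Sub : Set₁
Sub = V → Set

_⊆_ : Sub → Sub → Set
W ⊆ W' = ∀ x → W x → W' x

_≐_ : Sub → Sub → Set
W ≐ W' = ∀ x → W x ⇔ W' x

Indep1 : V → Set
Indep1 u = ¬ (u ≡ zeroV)

Indep2 : V → V → Set
Indep2 u v = ∀ a b → IsF4 a → IsF4 b → a · u +V b · v ≡ zeroV → (a ≡ zeroF × b ≡ zeroF)

Indep3 : V → V → V → Set
Indep3 u v w = ∀ a b c → IsF4 a → IsF4 b → IsF4 c →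
  a · u +V b · v +V c · w ≡ zeroV → (a ≡ zeroF × b ≡ zeroF × c ≡ zeroF)

Span1 : V → Sub
Span1 u x = ∃[ a ] (IsF4 a × x ≡ a · u)

Span2 : V → V → Sub
Span2 u v x = ∃[ a ] ∃[ b ] (IsF4 a × IsF4 b × x ≡ a · u +V b · v)

Span3 : V → V → V → Sub
Span3 u v w x = ∃[ a ] ∃[ b ] ∃[ c ] (IsF4 a × IsF4 b × IsF4 c × x ≡ a · u +V b · v +V c · w)

IsPoint : Sub → Set
IsPoint W = ∃[ u ] (Indep1 u × W ≐ Span1 u)

IsLine : Sub → Set
IsLine W = ∃[ u ] ∃[ v ] (Indep2 u v × W ≐ Span2 u v)

IsPlane : Sub → Set
IsPlane W = ∃[ u ] ∃[ v ] ∃[ w ] (Indep3 u v w × W ≐ Span3 u v w)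

SpanF16 : V → Sub
SpanF16 w x = ∃[ λ' ] (x ≡ λ' · w)

InŜ : Sub → Set
InŜ L = IsLine L × ∃[ w ] (Indep1 w × L ≐ SpanF16 w)

s : Sub
s (x , y) = x ≡ zeroF

InS : Sub → Set
InS L = InŜ L × ¬ (L ≐ s)

InA : Sub → Set
InA L = IsLine L × ¬ InŜ L × (∀ x → L x → s x → x ≡ zeroV)

gmap : F16 → F16 → F16 → V → V
gmap a b c (x , y) = (a *F x) , (c *F x +F b *F y)

image : (V → V) → Sub → Sub
image f W x = ∃[ y ] (W y × x ≡ f y)

InG-orbit : Sub → Sub → Set
InG-orbit ℓ L = ∃[ a ] ∃[ b ] ∃[ c ]
  (a ^F 5 ≡ oneF × b ^F 5 ≡ oneF × L ≐ image (gmap a b c) ℓ)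

InO' : Sub → Sub → Set
InO' ℓ L = InS L ⊎ InG-orbit ℓ L

IsHyperoval : (Sub → Set) → Set₁
IsHyperoval O = ∀ p P → IsPoint p → IsPlane P → p ⊆ P →
  let Through : Sub → Set
      Through L = IsLine L × O L × p ⊆ L × L ⊆ P
  in (∀ L → ¬ Through L)
     ⊎ (∃[ L₁ ] ∃[ L₂ ] (Through L₁ × Through L₂ × ¬ (L₁ ≐ L₂) ×
          (∀ L → Through L → (L ≐ L₁) ⊎ (L ≐ L₂))))

module Submission where

-- Every line of Π disjoint from s is the graph {(x , α x + β x⁴)} of an F4-linear map of F16.
-- Such a graph is in Ŝ iff β = 0, and (x , y) ↦ (a x , c x + b y) sends the graph of (α , β)
-- to that of ((c + b α) a⁴ , a b β); so the G-orbit of ℓ consists of the graphs whose β has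
-- the same norm κ = β⁵ ∈ F4ˣ as that of ℓ, and O' is the set of graphs with β in
-- H = {0} ∪ {β | β⁵ = κ}.
-- Let p = ⟨(x₀ , y₀)⟩ ⊆ P. If x₀ = 0 then p ⊆ s lies on no graph. Otherwise for every β there
-- is exactly one graph M β with slope β through p, and M β ⊆ P iff its point v β above t x₀
-- lies in P. Since v is affine in β and P meets s in a single point (0 , z) (a plane is not
-- all of V, by counting), the admissible β are either none or an affine F4-line b + F4 z/x₀⁴
-- of F16 ≅ AG(2,4). Finally H is a conic of AG(2,4) together with its nucleus, i.e. a
-- hyperoval, so every affine line meets it in 0 or 2 points.

open import Defs
open import Algebra.Bundles using (CommutativeRing)
open import Algebra.Structures using (IsCommutativeRing)
open import Data.Bool.Base using (Bool; true; false)
open import Data.Bool.Properties using () renaming (_≟_ to _≟ᴮ_)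
open import Data.Fin.Base using (Fin; combine)
open import Data.Fin.Properties using (2↔Bool; *↔×; combine-injective; <⇒notInjective)
open import Data.List.Base using (List; []; _∷_; length; filter)
open import Data.List.Membership.Propositional using (_∈_)
open import Data.List.Membership.Propositional.Properties using (∈-filter⁺; ∈-filter⁻)
open import Data.List.Membership.Setoid.Properties using (index-injective)
open import Data.List.Relation.Unary.All using ([]; _∷_)
open import Data.List.Relation.Unary.AllPairs using ([]; _∷_)
open import Data.List.Relation.Unary.Any as Any using (here; there)
open import Data.List.Relation.Unary.Unique.Propositional using (Unique)
open import Data.List.Relation.Unary.Unique.Propositional.Properties using (filter⁺)
open import Data.Nat.Base as ℕ using (ℕ; zero; suc)
open import Data.Nat.Properties as ℕ using ()
open import Data.Product.Base using (_×_; _,_; ∃; ∃₂; ∃-syntax; proj₁; proj₂)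
open import Data.Product.Function.NonDependent.Propositional using (_×-↔_)
open import Data.Product.Properties using (≡-dec)
open import Data.Sum.Base as Sum using (_⊎_; inj₁; inj₂; [_,_]′; fromInj₂)
open import Function.Base using (_∘_)
open import Function.Bundles using (_↔_; _⇔_; mk↔ₛ′; mk⇔; Equivalence; Injection)
open import Function.Properties.Inverse using (↔-sym; ↔-trans; ↔⇒↣)
open import Level using (_⊔_)
open import Relation.Binary.Core using (Rel)
open import Relation.Binary.Definitions using (DecidableEquality)
open import Relation.Binary.PropositionalEquality
  using (_≡_; _≢_; refl; sym; trans; cong; cong₂; subst; isEquivalence; module ≡-Reasoning)
open import Relation.Binary.PropositionalEquality.Properties using (setoid)
open import Relation.Nullary.Decidable
  using (Dec; yes; no; map′; from-yes; dec⇒maybe; _×-dec_; _⊎-dec_; _→-dec_; ¬?; decidable-stable)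
open import Relation.Nullary.Negation using (¬_; contradiction)
open import Relation.Unary using (Pred; Decidable)
open import Tactic.RingSolver using (solve-∀)
open import Tactic.RingSolver.Core.AlmostCommutativeRing using (AlmostCommutativeRing; fromCommutativeRing)

ZeroOrTwo : ∀ {a ℓ p} {A : Set a} → Rel A ℓ → Pred A p → Set (a ⊔ ℓ ⊔ p)
ZeroOrTwo _≈_ Q = (∀ x → ¬ Q x) ⊎ ∃[ x₁ ] ∃[ x₂ ] (Q x₁ × Q x₂ × ¬ (x₁ ≈ x₂) × (∀ x → Q x → (x ≈ x₁) ⊎ (x ≈ x₂)))

ZeroOrTwo-map : ∀ {a b ℓ p q} {A : Set a} {B : Set b} {_≈_ : Rel B ℓ} {Q : Pred A p} {Q′ : Pred B q} (f : A → B) →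
  (∀ {x} → Q x → Q′ (f x)) → (∀ {y} → Q′ y → ∃ λ x → Q x × y ≈ f x) → (∀ {x₁ x₂} → f x₁ ≈ f x₂ → x₁ ≡ x₂) →
  ZeroOrTwo _≡_ Q → ZeroOrTwo _≈_ Q′
ZeroOrTwo-map f Q⇒Q′ Q′⇒Q f-injective (inj₁ none) =
  inj₁ λ y Q′y → let x , Qx , _ = Q′⇒Q Q′y in none x Qx
ZeroOrTwo-map {_≈_ = _≈_} {Q = Q} f Q⇒Q′ Q′⇒Q f-injective (inj₂ (x₁ , x₂ , Qx₁ , Qx₂ , x₁≢x₂ , only)) =
  inj₂ (f x₁ , f x₂ , Q⇒Q′ Qx₁ , Q⇒Q′ Qx₂ , x₁≢x₂ ∘ f-injective , λ y Q′y → image-of y (Q′⇒Q Q′y))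
  where
  image-of : ∀ y → (∃ λ x → Q x × y ≈ f x) → y ≈ f x₁ ⊎ y ≈ f x₂
  image-of y (x , Qx , y≈fx) = Sum.map (λ { refl → y≈fx }) (λ { refl → y≈fx }) (only x Qx)

ZeroOrTwo-fromList : ∀ {a p} {A : Set a} {Q : Pred A p} (xs : List A) → Unique xs → (∀ x → Q x ⇔ x ∈ xs) →
                     length xs ≡ 0 ⊎ length xs ≡ 2 → ZeroOrTwo _≡_ Q
ZeroOrTwo-fromList [] _ Q⇔∈ _ = inj₁ λ x Qx → case-empty (Equivalence.to (Q⇔∈ x) Qx)
  where
  case-empty : ∀ {x} → ¬ x ∈ []
  case-empty ()
ZeroOrTwo-fromList (x₁ ∷ x₂ ∷ []) ((x₁≢x₂ ∷ []) ∷ _) Q⇔∈ _ =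
  inj₂ (x₁ , x₂ , Equivalence.from (Q⇔∈ x₁) (here refl) , Equivalence.from (Q⇔∈ x₂) (there (here refl)) , x₁≢x₂ ,
        λ x Qx → two-cases (Equivalence.to (Q⇔∈ x) Qx))
  where
  two-cases : ∀ {x} → x ∈ x₁ ∷ x₂ ∷ [] → x ≡ x₁ ⊎ x ≡ x₂
  two-cases (here x≡x₁)         = inj₁ x≡x₁
  two-cases (there (here x≡x₂)) = inj₂ x≡x₂
ZeroOrTwo-fromList (_ ∷ [])        _ _ (inj₁ ())
ZeroOrTwo-fromList (_ ∷ [])        _ _ (inj₂ ())
ZeroOrTwo-fromList (_ ∷ _ ∷ _ ∷ _) _ _ (inj₁ ())
ZeroOrTwo-fromList (_ ∷ _ ∷ _ ∷ _) _ _ (inj₂ ())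

-- Arithmetic in F16

∀ᴮ? : ∀ {p} {P : Pred Bool p} → Decidable P → Dec (∀ b → P b)
∀ᴮ? P? = map′ (λ (P-false , P-true) → λ { false → P-false ; true → P-true }) (λ h → h false , h true)
              (P? false ×-dec P? true)

∃ᴮ? : ∀ {p} {P : Pred Bool p} → Decidable P → Dec (∃ P)
∃ᴮ? P? = map′ [ (false ,_) , (true ,_) ]′ (λ { (false , p) → inj₁ p ; (true , p) → inj₂ p })
              (P? false ⊎-dec P? true)

∀? : ∀ {p} {P : Pred F16 p} → Decidable P → Dec (∀ x → P x)
∀? P? = map′ (λ h x → h (c0 x) (c1 x) (c2 x) (c3 x)) (λ h a b c d → h (mk a b c d))
             (∀ᴮ? λ a → ∀ᴮ? λ b → ∀ᴮ? λ c → ∀ᴮ? λ d → P? (mk a b c d))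

∃? : ∀ {p} {P : Pred F16 p} → Decidable P → Dec (∃ P)
∃? P? = map′ (λ (a , b , c , d , p) → mk a b c d , p) (λ (x , p) → c0 x , c1 x , c2 x , c3 x , p)
             (∃ᴮ? λ a → ∃ᴮ? λ b → ∃ᴮ? λ c → ∃ᴮ? λ d → P? (mk a b c d))

infix 4 _≟_
_≟_ : DecidableEquality F16
mk a b c d ≟ mk a′ b′ c′ d′ =
  map′ (λ { (refl , refl , refl , refl) → refl }) (λ { refl → refl , refl , refl , refl })
       (a ≟ᴮ a′ ×-dec b ≟ᴮ b′ ×-dec c ≟ᴮ c′ ×-dec d ≟ᴮ d′)

+F-assoc : ∀ a b c → (a +F b) +F c ≡ a +F (b +F c)
+F-assoc = from-yes (∀? λ a → ∀? λ b → ∀? λ c → (a +F b) +F c ≟ a +F (b +F c))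

+F-comm : ∀ a b → a +F b ≡ b +F a
+F-comm = from-yes (∀? λ a → ∀? λ b → a +F b ≟ b +F a)

+F-identityˡ : ∀ a → zeroF +F a ≡ a
+F-identityˡ = from-yes (∀? λ a → zeroF +F a ≟ a)

+F-same : ∀ a → a +F a ≡ zeroF
+F-same = from-yes (∀? λ a → a +F a ≟ zeroF)

*F-assoc : ∀ a b c → (a *F b) *F c ≡ a *F (b *F c)
*F-assoc = from-yes (∀? λ a → ∀? λ b → ∀? λ c → (a *F b) *F c ≟ a *F (b *F c))

*F-comm : ∀ a b → a *F b ≡ b *F a
*F-comm = from-yes (∀? λ a → ∀? λ b → a *F b ≟ b *F a)

*F-identityˡ : ∀ a → oneF *F a ≡ a
*F-identityˡ = from-yes (∀? λ a → oneF *F a ≟ a)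

*F-distribˡ-+F : ∀ a b c → a *F (b +F c) ≡ a *F b +F a *F c
*F-distribˡ-+F = from-yes (∀? λ a → ∀? λ b → ∀? λ c → a *F (b +F c) ≟ a *F b +F a *F c)

F16-isCommutativeRing : IsCommutativeRing _≡_ _+F_ _*F_ (λ x → x) zeroF oneF
F16-isCommutativeRing = record
  { isRing = record
    { +-isAbelianGroup = record
      { isGroup = record
        { isMonoid = record
          { isSemigroup = record
            { isMagma = record { isEquivalence = isEquivalence ; ∙-cong = cong₂ _+F_ }
            ; assoc = +F-assoc }
          ; identity = +F-identityˡ , λ a → trans (+F-comm a zeroF) (+F-identityˡ a) }
        ; inverse = +F-same , +F-same
        ; ⁻¹-cong = λ e → e }
      ; comm = +F-comm }
    ; *-cong = cong₂ _*F_
    ; *-assoc = *F-assoc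
    ; *-identity = *F-identityˡ , λ a → trans (*F-comm a oneF) (*F-identityˡ a)
    ; distrib = *F-distribˡ-+F , λ a b c → trans (*F-comm (b +F c) a)
        (trans (*F-distribˡ-+F a b c) (cong₂ _+F_ (*F-comm a b) (*F-comm a c))) }
  ; *-comm = *F-comm }

F16-commutativeRing : CommutativeRing _ _
F16-commutativeRing = record { isCommutativeRing = F16-isCommutativeRing }

F16-ring : AlmostCommutativeRing _ _
F16-ring = fromCommutativeRing F16-commutativeRing (λ x → dec⇒maybe (zeroF ≟ x))

+F-identityʳ : ∀ a → a +F zeroF ≡ a
+F-identityʳ = solve-∀ F16-ring

*F-identityʳ : ∀ a → a *F oneF ≡ a
*F-identityʳ = solve-∀ F16-ring

*F-zeroˡ : ∀ a → zeroF *F a ≡ zeroF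
*F-zeroˡ = solve-∀ F16-ring

*F-zeroʳ : ∀ a → a *F zeroF ≡ zeroF
*F-zeroʳ = solve-∀ F16-ring

+F-cancel : ∀ {a b} → a +F b ≡ zeroF → a ≡ b
+F-cancel {a} {b} a+b≡0 = begin
  a               ≡⟨ add-twice a b ⟩
  (a +F b) +F b   ≡⟨ cong (_+F b) a+b≡0 ⟩
  zeroF +F b      ≡⟨ +F-identityˡ b ⟩
  b               ∎
  where
  open ≡-Reasoning
  add-twice : ∀ a b → a ≡ (a +F b) +F b
  add-twice = solve-∀ F16-ring

+F-cancelˡ : ∀ a {b c} → a +F b ≡ a +F c → b ≡ c
+F-cancelˡ a {b} {c} a+b≡a+c = trans (add-twice a b) (trans (cong (a +F_) a+b≡a+c) (sym (add-twice a c)))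
  where
  add-twice : ∀ a b → b ≡ a +F (a +F b)
  add-twice = solve-∀ F16-ring

1≢0 : oneF ≢ zeroF
1≢0 ()

t : F16
t = mk false true false false

-- Opaque because unfolding _*F_ on open terms yields exponentially large Boolean normal forms,
-- which unification would otherwise compute.
infix 30 _⁻¹
opaque
  _⁻¹ : F16 → F16
  x ⁻¹ = x ^F 14

  ⁻¹-inverseˡ : ∀ {x} → x ≢ zeroF → x ⁻¹ *F x ≡ oneF
  ⁻¹-inverseˡ {x} x≢0 = fromInj₂ (λ x≡0 → contradiction x≡0 x≢0) (zero-or-invertible x)
    where
    zero-or-invertible : ∀ x → x ≡ zeroF ⊎ x ⁻¹ *F x ≡ oneF
    zero-or-invertible = from-yes (∀? λ x → x ≟ zeroF ⊎-dec x ⁻¹ *F x ≟ oneF)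

*F⁻¹*F-cancel : ∀ {a} x → a ≢ zeroF → x *F a ⁻¹ *F a ≡ x
*F⁻¹*F-cancel {a} x a≢0 = begin
  x *F a ⁻¹ *F a      ≡⟨ *F-assoc x (a ⁻¹) a ⟩
  x *F (a ⁻¹ *F a)    ≡⟨ cong (x *F_) (⁻¹-inverseˡ a≢0) ⟩
  x *F oneF           ≡⟨ *F-identityʳ x ⟩
  x                   ∎
  where open ≡-Reasoning

*F*F⁻¹-cancel : ∀ {a} x → a ≢ zeroF → x *F a *F a ⁻¹ ≡ x
*F*F⁻¹-cancel {a} x a≢0 = trans (swap x a (a ⁻¹)) (*F⁻¹*F-cancel x a≢0)
  where
  swap : ∀ x a b → x *F a *F b ≡ x *F b *F a
  swap = solve-∀ F16-ring

*F-cancelʳ : ∀ {a x y} → a ≢ zeroF → x *F a ≡ y *F a → x ≡ y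
*F-cancelʳ {a} {x} {y} a≢0 xa≡ya = begin
  x                ≡⟨ sym (*F*F⁻¹-cancel x a≢0) ⟩
  x *F a *F a ⁻¹   ≡⟨ cong (_*F a ⁻¹) xa≡ya ⟩
  y *F a *F a ⁻¹   ≡⟨ *F*F⁻¹-cancel y a≢0 ⟩
  y                ∎
  where open ≡-Reasoning

^F-distribʳ-*F : ∀ n x y → (x *F y) ^F n ≡ x ^F n *F y ^F n
^F-distribʳ-*F zero    x y = refl
^F-distribʳ-*F (suc n) x y = trans (cong (x *F y *F_) (^F-distribʳ-*F n x y)) (interchange x y (x ^F n) (y ^F n))
  where
  interchange : ∀ x y u v → x *F y *F (u *F v) ≡ x *F u *F (y *F v)
  interchange = solve-∀ F16-ring

^4-distrib-+F : ∀ x y → (x +F y) ^F 4 ≡ x ^F 4 +F y ^F 4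
^4-distrib-+F = from-yes (∀? λ x → ∀? λ y → (x +F y) ^F 4 ≟ x ^F 4 +F y ^F 4)

^4-involutive : ∀ x → (x ^F 4) ^F 4 ≡ x
^4-involutive = from-yes (∀? λ x → (x ^F 4) ^F 4 ≟ x)

^4-nonzero : ∀ x → x ≢ zeroF → x ^F 4 ≢ zeroF
^4-nonzero = from-yes (∀? λ x → ¬? (x ≟ zeroF) →-dec ¬? (x ^F 4 ≟ zeroF))

IsF4? : Decidable IsF4
IsF4? x = x ^F 4 ≟ x

IsF4-+F : ∀ {a b} → IsF4 a → IsF4 b → IsF4 (a +F b)
IsF4-+F {a} {b} a⁴≡a b⁴≡b = trans (^4-distrib-+F a b) (cong₂ _+F_ a⁴≡a b⁴≡b)

IsF4-*F : ∀ {a b} → IsF4 a → IsF4 b → IsF4 (a *F b)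
IsF4-*F {a} {b} a⁴≡a b⁴≡b = trans (^F-distribʳ-*F 4 a b) (cong₂ _*F_ a⁴≡a b⁴≡b)

norm-F4ˣ : ∀ x → x ≢ zeroF → IsF4 (x ^F 5) × x ^F 5 ≢ zeroF
norm-F4ˣ = from-yes (∀? λ x → ¬? (x ≟ zeroF) →-dec IsF4? (x ^F 5) ×-dec ¬? (x ^F 5 ≟ zeroF))

-- F4 = {0, 1, ω, ω²} with ω = t + t².
F4-elements : List F16
F4-elements = zeroF ∷ oneF ∷ mk false true true false ∷ mk true true true false ∷ []

IsF4⇔∈F4-elements : ∀ a → IsF4 a ⇔ a ∈ F4-elements
IsF4⇔∈F4-elements a = mk⇔ (IsF4⇒∈ a) (∈⇒IsF4 a)
  where
  open import Data.List.Membership.DecPropositional _≟_ using (_∈?_)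
  IsF4⇒∈ : ∀ a → IsF4 a → a ∈ F4-elements
  IsF4⇒∈ = from-yes (∀? λ a → IsF4? a →-dec a ∈? F4-elements)
  ∈⇒IsF4 : ∀ a → a ∈ F4-elements → IsF4 a
  ∈⇒IsF4 = from-yes (∀? λ a → a ∈? F4-elements →-dec IsF4? a)

F4-elements-unique : Unique F4-elements
F4-elements-unique = from-yes (unique? F4-elements)
  where open import Data.List.Relation.Unary.Unique.DecPropositional _≟_ using (unique?)

1,r-span : ∀ r → ¬ IsF4 r → ∀ y → ∃₂ λ c d → IsF4 c × IsF4 d × y ≡ c +F d *F r
1,r-span = from-yes (∀? λ r → ¬? (IsF4? r) →-dec ∀? λ y → ∃? λ c → ∃? λ d →
                       IsF4? c ×-dec IsF4? d ×-dec y ≟ c +F d *F r)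

F4-Independent : F16 → F16 → Set
F4-Independent u v = u ≢ zeroF × (∀ a → IsF4 a → v ≢ a *F u)

F4-Independent⇒span : ∀ {u v} → F4-Independent u v → ∀ y → ∃₂ λ c d → IsF4 c × IsF4 d × y ≡ c *F u +F d *F v
F4-Independent⇒span {u} {v} (u≢0 , v∉F4u) y =
  let c , d , c∈F4 , d∈F4 , y/u≡ = 1,r-span (v *F u ⁻¹) v/u∉F4 (y *F u ⁻¹)
  in c , d , c∈F4 , d∈F4 , rescale c d y/u≡
  where
  v/u∉F4 : ¬ IsF4 (v *F u ⁻¹)
  v/u∉F4 v/u∈F4 = v∉F4u (v *F u ⁻¹) v/u∈F4 (sym (*F⁻¹*F-cancel v u≢0))

  expand : ∀ c d v i u → (c +F d *F (v *F i)) *F u ≡ c *F u +F d *F (v *F i *F u)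
  expand = solve-∀ F16-ring

  rescale : ∀ c d → y *F u ⁻¹ ≡ c +F d *F (v *F u ⁻¹) → y ≡ c *F u +F d *F v
  rescale c d y/u≡ = begin
    y                                ≡⟨ sym (*F⁻¹*F-cancel y u≢0) ⟩
    y *F u ⁻¹ *F u                   ≡⟨ cong (_*F u) y/u≡ ⟩
    (c +F d *F (v *F u ⁻¹)) *F u     ≡⟨ expand c d v (u ⁻¹) u ⟩
    c *F u +F d *F (v *F u ⁻¹ *F u)  ≡⟨ cong (λ z → c *F u +F d *F z) (*F⁻¹*F-cancel v u≢0) ⟩
    c *F u +F d *F v                 ∎
    where open ≡-Reasoning

1,t-F4-Independent : F4-Independent oneF t
1,t-F4-Independent = 1≢0 , from-yes (∀? λ a → IsF4? a →-dec ¬? (t ≟ a *F oneF))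

1,t-independent : ∀ a b → IsF4 a → IsF4 b → a *F oneF +F b *F t ≡ zeroF → a ≡ zeroF × b ≡ zeroF
1,t-independent = from-yes (∀? λ a → ∀? λ b → IsF4? a →-dec IsF4? b →-dec
                              a *F oneF +F b *F t ≟ zeroF →-dec a ≟ zeroF ×-dec b ≟ zeroF)

F4-Dependent₃ : F16 → F16 → F16 → Set
F4-Dependent₃ x y z = ∃₂ λ a b → ∃ λ c → IsF4 a × IsF4 b × IsF4 c ×
  ¬ (a ≡ zeroF × b ≡ zeroF × c ≡ zeroF) × a *F x +F b *F y +F c *F z ≡ zeroF

F4-dependent₃ : ∀ x y z → F4-Dependent₃ x y z
F4-dependent₃ x y z = by-cases (x ≟ zeroF) (∃? λ a → IsF4? a ×-dec y ≟ a *F x)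
  where
  x-only : ∀ y z → oneF *F zeroF +F zeroF *F y +F zeroF *F z ≡ zeroF
  x-only = solve-∀ F16-ring
  y-multiple : ∀ a x z → a *F x +F oneF *F (a *F x) +F zeroF *F z ≡ zeroF
  y-multiple = solve-∀ F16-ring
  z-combination : ∀ c d x y → c *F x +F d *F y +F oneF *F (c *F x +F d *F y) ≡ zeroF
  z-combination = solve-∀ F16-ring

  by-cases : Dec (x ≡ zeroF) → Dec (∃ λ a → IsF4 a × y ≡ a *F x) → F4-Dependent₃ x y z
  by-cases (yes x≡0) _ = oneF , zeroF , zeroF , refl , refl , refl , (λ (1≡0 , _) → 1≢0 1≡0) ,
    trans (cong (λ x → oneF *F x +F zeroF *F y +F zeroF *F z) x≡0) (x-only y z)
  by-cases (no _) (yes (a , a∈F4 , y≡ax)) = a , oneF , zeroF , a∈F4 , refl , refl , (λ (_ , 1≡0 , _) → 1≢0 1≡0) ,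
    trans (cong (λ y → a *F x +F oneF *F y +F zeroF *F z) y≡ax) (y-multiple a x z)
  by-cases (no x≢0) (no y∉F4x) =
    from-span (F4-Independent⇒span (x≢0 , λ a a∈F4 y≡ax → y∉F4x (a , a∈F4 , y≡ax)) z)
    where
    from-span : (∃₂ λ c d → IsF4 c × IsF4 d × z ≡ c *F x +F d *F y) → F4-Dependent₃ x y z
    from-span (c , d , c∈F4 , d∈F4 , z≡) = c , d , oneF , c∈F4 , d∈F4 , refl , (λ (_ , _ , 1≡0) → 1≢0 1≡0) ,
      trans (cong (λ z → c *F x +F d *F y +F oneF *F z) z≡) (z-combination c d x y)

≐-refl : ∀ {W} → W ≐ W
≐-refl x = mk⇔ (λ w → w) (λ w → w)

≐-sym : ∀ {W W′} → W ≐ W′ → W′ ≐ W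
≐-sym W≐W′ x = mk⇔ (Equivalence.from (W≐W′ x)) (Equivalence.to (W≐W′ x))

≐-trans : ∀ {W W′ W″} → W ≐ W′ → W′ ≐ W″ → W ≐ W″
≐-trans W≐W′ W′≐W″ x = mk⇔ (Equivalence.to (W′≐W″ x) ∘ Equivalence.to (W≐W′ x))
                            (Equivalence.from (W≐W′ x) ∘ Equivalence.from (W′≐W″ x))

≐⇒⊆ : ∀ {W W′} → W ≐ W′ → W ⊆ W′
≐⇒⊆ W≐W′ x = Equivalence.to (W≐W′ x)

≐⇒⊇ : ∀ {W W′} → W ≐ W′ → W′ ⊆ W
≐⇒⊇ W≐W′ x = Equivalence.from (W≐W′ x)

⊆-antisym : ∀ {W W′} → W ⊆ W′ → W′ ⊆ W → W ≐ W′
⊆-antisym W⊆W′ W′⊆W x = mk⇔ (W⊆W′ x) (W′⊆W x)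

Disjoint : Sub → Sub → Set
Disjoint W W′ = ∀ x → W x → W′ x → x ≡ zeroV

+V-cancel : ∀ {u v} → u +V v ≡ zeroV → u ≡ v
+V-cancel u+v≡0 = cong₂ _,_ (+F-cancel (cong proj₁ u+v≡0)) (+F-cancel (cong proj₂ u+v≡0))

record IsSubspace (W : Sub) : Set where
  field
    zeroV-closed : W zeroV
    +V-closed    : ∀ {u v} → W u → W v → W (u +V v)
    ·-closed     : ∀ {a u} → IsF4 a → W u → W (a · u)

  lincomb-closed : ∀ {a b u v} → IsF4 a → IsF4 b → W u → W v → W (a · u +V b · v)
  lincomb-closed a∈F4 b∈F4 u∈W v∈W = +V-closed (·-closed a∈F4 u∈W) (·-closed b∈F4 v∈W)

open IsSubspace

IsSubspace-resp-≐ : ∀ {W W′} → W ≐ W′ → IsSubspace W → IsSubspace W′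
IsSubspace-resp-≐ W≐W′ W-sub = record
  { zeroV-closed = ≐⇒⊆ W≐W′ _ (zeroV-closed W-sub)
  ; +V-closed    = λ u∈ v∈ → ≐⇒⊆ W≐W′ _ (+V-closed W-sub (≐⇒⊇ W≐W′ _ u∈) (≐⇒⊇ W≐W′ _ v∈))
  ; ·-closed     = λ a∈F4 u∈ → ≐⇒⊆ W≐W′ _ (·-closed W-sub a∈F4 (≐⇒⊇ W≐W′ _ u∈))
  }

Span2-minimal : ∀ {W u v} → IsSubspace W → W u → W v → Span2 u v ⊆ W
Span2-minimal W-sub u∈W v∈W _ (a , b , a∈F4 , b∈F4 , refl) = lincomb-closed W-sub a∈F4 b∈F4 u∈W v∈W

Span2-isSubspace : ∀ u v → IsSubspace (Span2 u v)
Span2-isSubspace (u₁ , u₂) (v₁ , v₂) = record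
  { zeroV-closed = zeroF , zeroF , refl , refl , cong₂ _,_ (zero-comb u₁ v₁) (zero-comb u₂ v₂)
  ; +V-closed    = λ { (a , b , a∈ , b∈ , refl) (a′ , b′ , a′∈ , b′∈ , refl) →
      a +F a′ , b +F b′ , IsF4-+F a∈ a′∈ , IsF4-+F b∈ b′∈ ,
      cong₂ _,_ (sum-comb a b a′ b′ u₁ v₁) (sum-comb a b a′ b′ u₂ v₂) }
  ; ·-closed     = λ { {c} c∈ (a , b , a∈ , b∈ , refl) →
      c *F a , c *F b , IsF4-*F c∈ a∈ , IsF4-*F c∈ b∈ ,
      cong₂ _,_ (scale-comb c a b u₁ v₁) (scale-comb c a b u₂ v₂) }
  }
  where
  zero-comb : ∀ p q → zeroF ≡ zeroF *F p +F zeroF *F q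
  zero-comb = solve-∀ F16-ring
  sum-comb : ∀ a b a′ b′ p q → (a *F p +F b *F q) +F (a′ *F p +F b′ *F q) ≡ (a +F a′) *F p +F (b +F b′) *F q
  sum-comb = solve-∀ F16-ring
  scale-comb : ∀ c a b p q → c *F (a *F p +F b *F q) ≡ (c *F a) *F p +F (c *F b) *F q
  scale-comb = solve-∀ F16-ring

Span3-isSubspace : ∀ u v w → IsSubspace (Span3 u v w)
Span3-isSubspace (u₁ , u₂) (v₁ , v₂) (w₁ , w₂) = record
  { zeroV-closed = zeroF , zeroF , zeroF , refl , refl , refl ,
      cong₂ _,_ (zero-comb u₁ v₁ w₁) (zero-comb u₂ v₂ w₂)
  ; +V-closed    = λ { (a , b , c , a∈ , b∈ , c∈ , refl) (a′ , b′ , c′ , a′∈ , b′∈ , c′∈ , refl) →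
      a +F a′ , b +F b′ , c +F c′ , IsF4-+F a∈ a′∈ , IsF4-+F b∈ b′∈ , IsF4-+F c∈ c′∈ ,
      cong₂ _,_ (sum-comb a b c a′ b′ c′ u₁ v₁ w₁) (sum-comb a b c a′ b′ c′ u₂ v₂ w₂) }
  ; ·-closed     = λ { {d} d∈ (a , b , c , a∈ , b∈ , c∈ , refl) →
      d *F a , d *F b , d *F c , IsF4-*F d∈ a∈ , IsF4-*F d∈ b∈ , IsF4-*F d∈ c∈ ,
      cong₂ _,_ (scale-comb d a b c u₁ v₁ w₁) (scale-comb d a b c u₂ v₂ w₂) }
  }
  where
  zero-comb : ∀ p q r → zeroF ≡ zeroF *F p +F zeroF *F q +F zeroF *F r
  zero-comb = solve-∀ F16-ring
  sum-comb : ∀ a b c a′ b′ c′ p q r →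
    (a *F p +F b *F q +F c *F r) +F (a′ *F p +F b′ *F q +F c′ *F r) ≡
    (a +F a′) *F p +F (b +F b′) *F q +F (c +F c′) *F r
  sum-comb = solve-∀ F16-ring
  scale-comb : ∀ d a b c p q r →
    d *F (a *F p +F b *F q +F c *F r) ≡ (d *F a) *F p +F (d *F b) *F q +F (d *F c) *F r
  scale-comb = solve-∀ F16-ring

-- Lines disjoint from s as graphs

-- Opaque for the same reason as _⁻¹.
opaque
  linMap : F16 → F16 → F16 → F16
  linMap α β x = α *F x +F β *F x ^F 4

  linMap-def : ∀ α β x → linMap α β x ≡ α *F x +F β *F x ^F 4
  linMap-def α β x = refl

Graph : F16 → F16 → Sub
Graph α β (x , y) = y ≡ linMap α β x

linMap-+F : ∀ α β x x′ → linMap α β (x +F x′) ≡ linMap α β x +F linMap α β x′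
linMap-+F α β x x′ = begin
  linMap α β (x +F x′)                                 ≡⟨ linMap-def α β (x +F x′) ⟩
  α *F (x +F x′) +F β *F (x +F x′) ^F 4                ≡⟨ cong (λ z → α *F (x +F x′) +F β *F z) (^4-distrib-+F x x′) ⟩
  α *F (x +F x′) +F β *F (x ^F 4 +F x′ ^F 4)           ≡⟨ regroup α β x x′ (x ^F 4) (x′ ^F 4) ⟩
  (α *F x +F β *F x ^F 4) +F (α *F x′ +F β *F x′ ^F 4) ≡⟨ sym (cong₂ _+F_ (linMap-def α β x) (linMap-def α β x′)) ⟩
  linMap α β x +F linMap α β x′                        ∎
  where
  open ≡-Reasoning
  regroup : ∀ α β x x′ X X′ → α *F (x +F x′) +F β *F (X +F X′) ≡ (α *F x +F β *F X) +F (α *F x′ +F β *F X′)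
  regroup = solve-∀ F16-ring

linMap-·F4 : ∀ α β a x → IsF4 a → linMap α β (a *F x) ≡ a *F linMap α β x
linMap-·F4 α β a x a⁴≡a = begin
  linMap α β (a *F x)                          ≡⟨ linMap-def α β (a *F x) ⟩
  α *F (a *F x) +F β *F (a *F x) ^F 4          ≡⟨ cong (λ z → α *F (a *F x) +F β *F z) (^F-distribʳ-*F 4 a x) ⟩
  α *F (a *F x) +F β *F (a ^F 4 *F x ^F 4)     ≡⟨ cong (λ z → α *F (a *F x) +F β *F (z *F x ^F 4)) a⁴≡a ⟩
  α *F (a *F x) +F β *F (a *F x ^F 4)          ≡⟨ factor α β a x (x ^F 4) ⟩
  a *F (α *F x +F β *F x ^F 4)                 ≡⟨ cong (a *F_) (sym (linMap-def α β x)) ⟩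
  a *F linMap α β x                            ∎
  where
  open ≡-Reasoning
  factor : ∀ α β a x X → α *F (a *F x) +F β *F (a *F X) ≡ a *F (α *F x +F β *F X)
  factor = solve-∀ F16-ring

linMap-zero : ∀ α β → linMap α β zeroF ≡ zeroF
linMap-zero α β = trans (linMap-def α β zeroF) (vanish α β)
  where
  vanish : ∀ α β → α *F zeroF +F β *F zeroF ^F 4 ≡ zeroF
  vanish = solve-∀ F16-ring

Graph-isSubspace : ∀ α β → IsSubspace (Graph α β)
Graph-isSubspace α β = record
  { zeroV-closed = sym (linMap-zero α β)
  ; +V-closed    = λ { {x , _} {x′ , _} refl refl → sym (linMap-+F α β x x′) }
  ; ·-closed     = λ { {a} {x , _} a∈F4 refl → sym (linMap-·F4 α β a x a∈F4) }
  }

Graph-x-injective : ∀ {α β u v} → Graph α β u → Graph α β v → proj₁ u ≡ proj₁ v → u ≡ v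
Graph-x-injective u∈ v∈ refl = cong (_ ,_) (trans u∈ (sym v∈))

Graph-≐-Span2 : ∀ {α β u v} → Graph α β u → Graph α β v → F4-Independent (proj₁ u) (proj₁ v) →
                Graph α β ≐ Span2 u v
Graph-≐-Span2 {α} {β} {u} {v} u∈ v∈ indep =
  ⊆-antisym (λ w w∈ → from-coords w w∈ (F4-Independent⇒span indep (proj₁ w)))
            (Span2-minimal (Graph-isSubspace α β) u∈ v∈)
  where
  from-coords : ∀ w → Graph α β w → (∃₂ λ c d → IsF4 c × IsF4 d × proj₁ w ≡ c *F proj₁ u +F d *F proj₁ v) →
                Span2 u v w
  from-coords w w∈ (c , d , c∈F4 , d∈F4 , x≡) =
    c , d , c∈F4 , d∈F4 , Graph-x-injective w∈ (lincomb-closed (Graph-isSubspace α β) c∈F4 d∈F4 u∈ v∈) x≡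

Graph-cong : ∀ {α α′ β β′} → α ≡ α′ → β ≡ β′ → Graph α β ≐ Graph α′ β′
Graph-cong refl refl = ≐-refl

Graph-≐-Span2-basis : ∀ α β → Graph α β ≐ Span2 (oneF , linMap α β oneF) (t , linMap α β t)
Graph-≐-Span2-basis α β = Graph-≐-Span2 refl refl 1,t-F4-Independent

Graph-isLine : ∀ α β → IsLine (Graph α β)
Graph-isLine α β = _ , _ , indep , Graph-≐-Span2-basis α β
  where
  indep : Indep2 (oneF , linMap α β oneF) (t , linMap α β t)
  indep a b a∈F4 b∈F4 comb≡0 = 1,t-independent a b a∈F4 b∈F4 (cong proj₁ comb≡0)

-- Solve α + β = y₁ and α t + β t⁴ = y₂, using t⁴ = t + 1.
interpolation : ∀ y₁ y₂ → ∃₂ λ α β → linMap α β oneF ≡ y₁ × linMap α β t ≡ y₂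
interpolation y₁ y₂ = y₁ +F (y₂ +F t *F y₁) , y₂ +F t *F y₁ ,
  trans (linMap-def _ _ oneF) (at-1 y₁ y₂) , trans (linMap-def _ _ t) (at-t y₁ y₂)
  where
  at-1 : ∀ y₁ y₂ → (y₁ +F (y₂ +F t *F y₁)) *F oneF +F (y₂ +F t *F y₁) *F oneF ^F 4 ≡ y₁
  at-1 = solve-∀ F16-ring
  at-t : ∀ y₁ y₂ → (y₁ +F (y₂ +F t *F y₁)) *F t +F (y₂ +F t *F y₁) *F t ^F 4 ≡ y₂
  at-t = solve-∀ F16-ring

disjoint-subspace-⊇-Graph : ∀ {W α β} → IsSubspace W → Disjoint W s → Graph α β ⊆ W → W ≐ Graph α β
disjoint-subspace-⊇-Graph {W} {α} {β} W-sub disj Graph⊆W = ⊆-antisym W⊆Graph Graph⊆W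
  where
  W⊆Graph : W ⊆ Graph α β
  W⊆Graph (x , y) w∈W = cong proj₂ (+V-cancel {x , y} {x , linMap α β x}
    (disj _ (+V-closed W-sub w∈W (Graph⊆W (x , linMap α β x) refl)) (+F-same x)))

disjoint-subspace-≐-Graph : ∀ {W} α β → IsSubspace W → Disjoint W s →
  W (oneF , linMap α β oneF) → W (t , linMap α β t) → W ≐ Graph α β
disjoint-subspace-≐-Graph α β W-sub disj e₁∈W e₂∈W =
  disjoint-subspace-⊇-Graph W-sub disj (λ w w∈ → Span2-minimal W-sub e₁∈W e₂∈W w (≐⇒⊆ (Graph-≐-Span2-basis α β) w w∈))

disjoint-line⇒Graph : ∀ {ℓ} → IsLine ℓ → Disjoint ℓ s → ∃₂ λ α β → ℓ ≐ Graph α β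
disjoint-line⇒Graph {ℓ} (u , v , indep , ℓ≐) disj =
  graph-through (interpolation (proj₁ (point-over oneF)) (proj₁ (point-over t)))
  where
  ℓ-sub : IsSubspace ℓ
  ℓ-sub = IsSubspace-resp-≐ (≐-sym ℓ≐) (Span2-isSubspace u v)

  comb∈ℓ : ∀ a b → IsF4 a → IsF4 b → ℓ (a · u +V b · v)
  comb∈ℓ a b a∈F4 b∈F4 = ≐⇒⊇ ℓ≐ _ (a , b , a∈F4 , b∈F4 , refl)

  x-independent : ∀ a b → IsF4 a → IsF4 b → a *F proj₁ u +F b *F proj₁ v ≡ zeroF → a ≡ zeroF × b ≡ zeroF
  x-independent a b a∈F4 b∈F4 x≡0 = indep a b a∈F4 b∈F4 (disj _ (comb∈ℓ a b a∈F4 b∈F4) x≡0)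

  only-u : ∀ p q → oneF *F zeroF +F zeroF *F q ≡ zeroF
  only-u = solve-∀ F16-ring
  v-multiple : ∀ a p → a *F p +F oneF *F (a *F p) ≡ zeroF
  v-multiple = solve-∀ F16-ring

  x-F4-Independent : F4-Independent (proj₁ u) (proj₁ v)
  x-F4-Independent =
    (λ ux≡0 → 1≢0 (proj₁ (x-independent oneF zeroF refl refl
                    (trans (cong (λ z → oneF *F z +F zeroF *F proj₁ v) ux≡0) (only-u zeroF (proj₁ v)))))) ,
    (λ a a∈F4 vx≡aux → 1≢0 (proj₂ (x-independent a oneF a∈F4 refl
                    (trans (cong (λ z → a *F proj₁ u +F oneF *F z) vx≡aux) (v-multiple a (proj₁ u))))))

  point-over : ∀ x → ∃ λ y → ℓ (x , y)
  point-over x = lift (F4-Independent⇒span x-F4-Independent x)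
    where
    lift : (∃₂ λ c d → IsF4 c × IsF4 d × x ≡ c *F proj₁ u +F d *F proj₁ v) → ∃ λ y → ℓ (x , y)
    lift (c , d , c∈F4 , d∈F4 , x≡) =
      let y = proj₂ (c · u +V d · v) in y , subst (λ z → ℓ (z , y)) (sym x≡) (comb∈ℓ c d c∈F4 d∈F4)

  graph-through : (∃₂ λ α β → linMap α β oneF ≡ proj₁ (point-over oneF) × linMap α β t ≡ proj₁ (point-over t)) →
                  ∃₂ λ α β → ℓ ≐ Graph α β
  graph-through (α , β , at-1 , at-t) = α , β ,
    disjoint-subspace-≐-Graph α β ℓ-sub disj
      (subst (λ y → ℓ (oneF , y)) (sym at-1) (proj₂ (point-over oneF)))
      (subst (λ y → ℓ (t , y)) (sym at-t) (proj₂ (point-over t)))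

SpanF16-≐-Graph : ∀ x₀ y₀ → x₀ ≢ zeroF → SpanF16 (x₀ , y₀) ≐ Graph (y₀ *F x₀ ⁻¹) zeroF
SpanF16-≐-Graph x₀ y₀ x₀≢0 = ⊆-antisym span⊆graph graph⊆span
  where
  open ≡-Reasoning
  regroup : ∀ k y i x X → k *F (y *F i *F x) ≡ y *F i *F (k *F x) +F zeroF *F X
  regroup = solve-∀ F16-ring

  span⊆graph : SpanF16 (x₀ , y₀) ⊆ Graph (y₀ *F x₀ ⁻¹) zeroF
  span⊆graph _ (k , refl) = begin
    k *F y₀                                                   ≡⟨ cong (k *F_) (sym (*F⁻¹*F-cancel y₀ x₀≢0)) ⟩
    k *F (y₀ *F x₀ ⁻¹ *F x₀)                                  ≡⟨ regroup k y₀ (x₀ ⁻¹) x₀ ((k *F x₀) ^F 4) ⟩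
    y₀ *F x₀ ⁻¹ *F (k *F x₀) +F zeroF *F (k *F x₀) ^F 4       ≡⟨ sym (linMap-def (y₀ *F x₀ ⁻¹) zeroF (k *F x₀)) ⟩
    linMap (y₀ *F x₀ ⁻¹) zeroF (k *F x₀)                      ∎

  rescale : ∀ x i y X → y *F i *F x +F zeroF *F X ≡ x *F i *F y
  rescale = solve-∀ F16-ring

  graph⊆span : Graph (y₀ *F x₀ ⁻¹) zeroF ⊆ SpanF16 (x₀ , y₀)
  graph⊆span (x , y) y≡ = x *F x₀ ⁻¹ , cong₂ _,_ (sym (*F⁻¹*F-cancel x x₀≢0)) (begin
    y                                               ≡⟨ y≡ ⟩
    linMap (y₀ *F x₀ ⁻¹) zeroF x                    ≡⟨ linMap-def (y₀ *F x₀ ⁻¹) zeroF x ⟩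
    y₀ *F x₀ ⁻¹ *F x +F zeroF *F x ^F 4             ≡⟨ rescale x (x₀ ⁻¹) y₀ (x ^F 4) ⟩
    x *F x₀ ⁻¹ *F y₀                                ∎)

SpanF16-≐-s : ∀ y₀ → y₀ ≢ zeroF → SpanF16 (zeroF , y₀) ≐ s
SpanF16-≐-s y₀ y₀≢0 = ⊆-antisym (λ { _ (k , refl) → *F-zeroʳ k })
  (λ { (x , y) x≡0 → y *F y₀ ⁻¹ , cong₂ _,_ (trans x≡0 (sym (*F-zeroʳ (y *F y₀ ⁻¹)))) (sym (*F⁻¹*F-cancel y y₀≢0)) })

Graph-zero-≐-SpanF16 : ∀ α → Graph α zeroF ≐ SpanF16 (oneF , α)
Graph-zero-≐-SpanF16 α = ≐-trans (Graph-cong α≡α/1 refl) (≐-sym (SpanF16-≐-Graph oneF α 1≢0))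
  where
  α≡α/1 : α ≡ α *F oneF ⁻¹
  α≡α/1 = trans (sym (*F⁻¹*F-cancel α 1≢0)) (*F-identityʳ (α *F oneF ⁻¹))

Graph-zero-InS : ∀ α → InS (Graph α zeroF)
Graph-zero-InS α = (Graph-isLine α zeroF , (oneF , α) , (λ eq → 1≢0 (cong proj₁ eq)) , Graph-zero-≐-SpanF16 α) ,
                   λ Graph≐s → 1≢0 (trans (≐⇒⊇ Graph≐s (zeroF , oneF) refl) (linMap-zero α zeroF))

InS⇒Graph : ∀ {L} → InS L → ∃ λ α → L ≐ Graph α zeroF
InS⇒Graph {L} ((_ , (x₀ , y₀) , w≢0 , L≐) , L≢s) = by-cases (x₀ ≟ zeroF)
  where
  by-cases : Dec (x₀ ≡ zeroF) → ∃ λ α → L ≐ Graph α zeroF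
  by-cases (yes x₀≡0) =
    contradiction (≐-trans L≐ (subst (λ z → SpanF16 (z , y₀) ≐ s) (sym x₀≡0) (SpanF16-≐-s y₀ y₀≢0))) L≢s
    where
    y₀≢0 : y₀ ≢ zeroF
    y₀≢0 y₀≡0 = w≢0 (cong₂ _,_ x₀≡0 y₀≡0)
  by-cases (no x₀≢0) = y₀ *F x₀ ⁻¹ , ≐-trans L≐ (SpanF16-≐-Graph x₀ y₀ x₀≢0)

InA⇒Graph : ∀ {ℓ} → InA ℓ → ∃₂ λ α β → β ≢ zeroF × ℓ ≐ Graph α β
InA⇒Graph {ℓ} (ℓ-line , ℓ∉Ŝ , disj) = not-in-Ŝ (disjoint-line⇒Graph ℓ-line disj)
  where
  not-in-Ŝ : (∃₂ λ α β → ℓ ≐ Graph α β) → ∃₂ λ α β → β ≢ zeroF × ℓ ≐ Graph α β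
  not-in-Ŝ (α , β , ℓ≐) = α , β ,
    (λ β≡0 → ℓ∉Ŝ (ℓ-line , (oneF , α) , (λ eq → 1≢0 (cong proj₁ eq)) ,
                  ≐-trans ℓ≐ (≐-trans (Graph-cong refl β≡0) (Graph-zero-≐-SpanF16 α)))) ,
    ℓ≐

-- The action of G

image-resp-≐ : ∀ f {W W′} → W ≐ W′ → image f W ≐ image f W′
image-resp-≐ f W≐W′ = ⊆-antisym (λ { _ (y , y∈ , refl) → y , ≐⇒⊆ W≐W′ y y∈ , refl })
                                (λ { _ (y , y∈ , refl) → y , ≐⇒⊇ W≐W′ y y∈ , refl })

image-Graph : ∀ a b c α β → a ^F 5 ≡ oneF →
  image (gmap a b c) (Graph α β) ≐ Graph ((c +F b *F α) *F a ^F 4) (a *F b *F β)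
image-Graph a b c α β a⁵≡1 = ⊆-antisym image⊆Graph Graph⊆image
  where
  open ≡-Reasoning
  A α′ β′ : F16
  A  = a ^F 4
  α′ = (c +F b *F α) *F A
  β′ = a *F b *F β

  aA≡1 : a *F A ≡ oneF
  aA≡1 = a⁵≡1

  forward : ∀ a A b c α β x X → (c *F x +F b *F (α *F x +F β *F X)) *F (a *F A) ≡
                                (c +F b *F α) *F A *F (a *F x) +F a *F b *F β *F (A *F X)
  forward = solve-∀ F16-ring

  image⊆Graph : image (gmap a b c) (Graph α β) ⊆ Graph α′ β′
  image⊆Graph _ ((x , y) , y≡ , refl) = begin
    c *F x +F b *F y                                    ≡⟨ cong (λ z → c *F x +F b *F z) (trans y≡ (linMap-def α β x)) ⟩
    c *F x +F b *F (α *F x +F β *F x ^F 4)              ≡⟨ sym (*F-identityʳ image-y) ⟩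
    (c *F x +F b *F (α *F x +F β *F x ^F 4)) *F oneF    ≡⟨ cong (image-y *F_) (sym aA≡1) ⟩
    (c *F x +F b *F (α *F x +F β *F x ^F 4)) *F (a *F A) ≡⟨ forward a A b c α β x (x ^F 4) ⟩
    α′ *F (a *F x) +F β′ *F (A *F x ^F 4)               ≡⟨ cong (λ z → α′ *F (a *F x) +F β′ *F z) (sym (^F-distribʳ-*F 4 a x)) ⟩
    α′ *F (a *F x) +F β′ *F (a *F x) ^F 4               ≡⟨ sym (linMap-def α′ β′ (a *F x)) ⟩
    linMap α′ β′ (a *F x)                               ∎
    where
    image-y : F16
    image-y = c *F x +F b *F (α *F x +F β *F x ^F 4)

  A⁴≡a : A ^F 4 ≡ a
  A⁴≡a = ^4-involutive a

  backward : ∀ a A b c α β X X′ → (c +F b *F α) *F A *F X +F a *F b *F β *F X′ ≡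
                                  c *F (A *F X) +F b *F (α *F (A *F X) +F β *F (a *F X′))
  backward = solve-∀ F16-ring

  Graph⊆image : Graph α′ β′ ⊆ image (gmap a b c) (Graph α β)
  Graph⊆image (X , Y) Y≡ = (A *F X , linMap α β (A *F X)) , refl , cong₂ _,_ X≡ (begin
    Y                                                         ≡⟨ trans Y≡ (linMap-def α′ β′ X) ⟩
    α′ *F X +F β′ *F X ^F 4                                   ≡⟨ backward a A b c α β X (X ^F 4) ⟩
    c *F (A *F X) +F b *F (α *F (A *F X) +F β *F (a *F X ^F 4)) ≡⟨ cong (λ z → c *F (A *F X) +F b *F (α *F (A *F X) +F β *F z)) (sym (A-X⁴)) ⟩
    c *F (A *F X) +F b *F (α *F (A *F X) +F β *F (A *F X) ^F 4) ≡⟨ cong (λ z → c *F (A *F X) +F b *F z) (sym (linMap-def α β (A *F X))) ⟩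
    c *F (A *F X) +F b *F linMap α β (A *F X)                 ∎)
    where
    X≡ : X ≡ a *F (A *F X)
    X≡ = sym (trans (sym (*F-assoc a A X)) (trans (cong (_*F X) aA≡1) (*F-identityˡ X)))
    A-X⁴ : (A *F X) ^F 4 ≡ a *F X ^F 4
    A-X⁴ = trans (^F-distribʳ-*F 4 A X) (cong (_*F X ^F 4) A⁴≡a)

InG-orbit⇒Graph : ∀ {ℓ αℓ βℓ L} → ℓ ≐ Graph αℓ βℓ → InG-orbit ℓ L →
                  ∃₂ λ α β → β ^F 5 ≡ βℓ ^F 5 × L ≐ Graph α β
InG-orbit⇒Graph {ℓ} {αℓ} {βℓ} ℓ≐ (a , b , c , a⁵≡1 , b⁵≡1 , L≐) =
  (c +F b *F αℓ) *F a ^F 4 , a *F b *F βℓ , norm-preserved ,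
  ≐-trans L≐ (≐-trans (image-resp-≐ (gmap a b c) ℓ≐) (image-Graph a b c αℓ βℓ a⁵≡1))
  where
  open ≡-Reasoning
  norm-preserved : (a *F b *F βℓ) ^F 5 ≡ βℓ ^F 5
  norm-preserved = begin
    (a *F b *F βℓ) ^F 5          ≡⟨ ^F-distribʳ-*F 5 (a *F b) βℓ ⟩
    (a *F b) ^F 5 *F βℓ ^F 5     ≡⟨ cong (_*F βℓ ^F 5) (^F-distribʳ-*F 5 a b) ⟩
    a ^F 5 *F b ^F 5 *F βℓ ^F 5  ≡⟨ cong₂ (λ p q → p *F q *F βℓ ^F 5) a⁵≡1 b⁵≡1 ⟩
    oneF *F oneF *F βℓ ^F 5      ≡⟨ *F-identityˡ (βℓ ^F 5) ⟩
    βℓ ^F 5                      ∎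

Graph⇒InG-orbit : ∀ {ℓ αℓ βℓ} α β → βℓ ≢ zeroF → ℓ ≐ Graph αℓ βℓ → β ^F 5 ≡ βℓ ^F 5 →
                  InG-orbit ℓ (Graph α β)
Graph⇒InG-orbit {ℓ} {αℓ} {βℓ} α β βℓ≢0 ℓ≐ β⁵≡βℓ⁵ = oneF , b , c , refl , b⁵≡1 ,
  ≐-sym (≐-trans (image-resp-≐ (gmap oneF b c) ℓ≐)
                 (≐-trans (image-Graph oneF b c αℓ βℓ refl) (Graph-cong α-recovered β-recovered)))
  where
  open ≡-Reasoning
  b c : F16
  b = β *F βℓ ⁻¹
  c = α +F b *F αℓ

  b⁵≡1 : b ^F 5 ≡ oneF
  b⁵≡1 = begin
    (β *F βℓ ⁻¹) ^F 5          ≡⟨ ^F-distribʳ-*F 5 β (βℓ ⁻¹) ⟩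
    β ^F 5 *F βℓ ⁻¹ ^F 5       ≡⟨ cong (_*F βℓ ⁻¹ ^F 5) β⁵≡βℓ⁵ ⟩
    βℓ ^F 5 *F βℓ ⁻¹ ^F 5      ≡⟨ sym (^F-distribʳ-*F 5 βℓ (βℓ ⁻¹)) ⟩
    (βℓ *F βℓ ⁻¹) ^F 5         ≡⟨ cong (_^F 5) (trans (*F-comm βℓ (βℓ ⁻¹)) (⁻¹-inverseˡ βℓ≢0)) ⟩
    oneF ^F 5                  ≡⟨⟩
    oneF                       ∎

  cancel-twice : ∀ α x → (α +F x +F x) *F oneF ^F 4 ≡ α
  cancel-twice = solve-∀ F16-ring

  α-recovered : (c +F b *F αℓ) *F oneF ^F 4 ≡ α
  α-recovered = cancel-twice α (b *F αℓ)

  β-recovered : oneF *F b *F βℓ ≡ β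
  β-recovered = trans (cong (_*F βℓ) (*F-identityˡ b)) (*F⁻¹*F-cancel β βℓ≢0)

OnHyperoval : F16 → F16 → Set
OnHyperoval κ β = β ≡ zeroF ⊎ β ^F 5 ≡ κ

OnHyperoval? : ∀ κ → Decidable (OnHyperoval κ)
OnHyperoval? κ β = β ≟ zeroF ⊎-dec β ^F 5 ≟ κ

InO'⇒Graph : ∀ {ℓ αℓ βℓ L} → ℓ ≐ Graph αℓ βℓ → InO' ℓ L →
             ∃₂ λ α β → OnHyperoval (βℓ ^F 5) β × L ≐ Graph α β
InO'⇒Graph ℓ≐ (inj₁ L∈S) = let α , L≐ = InS⇒Graph L∈S in α , zeroF , inj₁ refl , L≐
InO'⇒Graph ℓ≐ (inj₂ L∈Gℓ) = let α , β , β⁵≡ , L≐ = InG-orbit⇒Graph ℓ≐ L∈Gℓ in α , β , inj₂ β⁵≡ , L≐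

Graph⇒InO' : ∀ {ℓ αℓ βℓ} α β → βℓ ≢ zeroF → ℓ ≐ Graph αℓ βℓ → OnHyperoval (βℓ ^F 5) β → InO' ℓ (Graph α β)
Graph⇒InO' α β βℓ≢0 ℓ≐ (inj₁ refl) = inj₁ (Graph-zero-InS α)
Graph⇒InO' α β βℓ≢0 ℓ≐ (inj₂ β⁵≡) = inj₂ (Graph⇒InG-orbit α β βℓ≢0 ℓ≐ β⁵≡)

-- A hyperoval of AG(2,4)

hyperoval-points : F16 → F16 → F16 → List F16
hyperoval-points κ b k = filter (λ a → OnHyperoval? κ (b +F a *F k)) F4-elements

hyperoval-points-size : ∀ κ b k → IsF4 κ → κ ≢ zeroF → k ≢ zeroF →
  length (hyperoval-points κ b k) ≡ 0 ⊎ length (hyperoval-points κ b k) ≡ 2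
hyperoval-points-size = from-yes (∀? λ κ → ∀? λ b → ∀? λ k → IsF4? κ →-dec ¬? (κ ≟ zeroF) →-dec ¬? (k ≟ zeroF) →-dec
  (length (hyperoval-points κ b k) ℕ.≟ 0 ⊎-dec length (hyperoval-points κ b k) ℕ.≟ 2))

affine-line-meets-hyperoval : ∀ κ b k → IsF4 κ → κ ≢ zeroF → k ≢ zeroF →
  ZeroOrTwo _≡_ (λ a → IsF4 a × OnHyperoval κ (b +F a *F k))
affine-line-meets-hyperoval κ b k κ∈F4 κ≢0 k≢0 =
  ZeroOrTwo-fromList (hyperoval-points κ b k) (filter⁺ on? F4-elements-unique) membership
                     (hyperoval-points-size κ b k κ∈F4 κ≢0 k≢0)
  where
  on? : Decidable (λ a → OnHyperoval κ (b +F a *F k))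
  on? = λ a → OnHyperoval? κ (b +F a *F k)
  membership : ∀ a → (IsF4 a × OnHyperoval κ (b +F a *F k)) ⇔ a ∈ hyperoval-points κ b k
  membership a = mk⇔ (λ (a∈F4 , on) → ∈-filter⁺ on? {x = a} (Equivalence.to (IsF4⇔∈F4-elements a) a∈F4) on)
                     (λ a∈ → let a∈F4s , on = ∈-filter⁻ on? {v = a} {xs = F4-elements} a∈ in Equivalence.from (IsF4⇔∈F4-elements a) a∈F4s , on)

-- Planes

plane-meets-s : ∀ {P} → IsPlane P → ∃ λ z → z ≢ zeroF × P (zeroF , z)
plane-meets-s {P} (u , v , w , indep , P≐) = from-relation (F4-dependent₃ (proj₁ u) (proj₁ v) (proj₁ w))
  where
  from-relation : F4-Dependent₃ (proj₁ u) (proj₁ v) (proj₁ w) → ∃ λ z → z ≢ zeroF × P (zeroF , z)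
  from-relation (a , b , c , a∈F4 , b∈F4 , c∈F4 , nontrivial , x≡0) =
    proj₂ comb , (λ z≡0 → nontrivial (indep a b c a∈F4 b∈F4 c∈F4 (cong₂ _,_ x≡0 z≡0))) ,
    subst P (cong₂ _,_ x≡0 refl) (≐⇒⊇ P≐ comb (a , b , c , a∈F4 , b∈F4 , c∈F4 , refl))
    where
    comb : V
    comb = a · u +V b · v +V c · w

F16↔Bool⁴ : F16 ↔ (Bool × Bool × Bool × Bool)
F16↔Bool⁴ = mk↔ₛ′ (λ x → c0 x , c1 x , c2 x , c3 x) (λ (a , b , c , d) → mk a b c d) (λ _ → refl) (λ _ → refl)

Fin256↔V : Fin 256 ↔ V
Fin256↔V = ↔-trans (*↔× {16} {16}) (Fin16↔F16 ×-↔ Fin16↔F16)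
  where
  Fin16↔F16 : Fin 16 ↔ F16
  Fin16↔F16 = ↔-trans (*↔× {2} {8}) (↔-trans (2↔Bool ×-↔ ↔-trans (*↔× {2} {4})
    (2↔Bool ×-↔ ↔-trans (*↔× {2} {2}) (2↔Bool ×-↔ 2↔Bool))) (↔-sym F16↔Bool⁴))

F4-index : ∀ a → IsF4 a → Fin 4
F4-index a a∈F4 = Any.index (Equivalence.to (IsF4⇔∈F4-elements a) a∈F4)

F4-index-injective : ∀ a b (a∈F4 : IsF4 a) (b∈F4 : IsF4 b) → F4-index a a∈F4 ≡ F4-index b b∈F4 → a ≡ b
F4-index-injective a b a∈F4 b∈F4 =
  index-injective (setoid F16) (Equivalence.to (IsF4⇔∈F4-elements a) a∈F4) (Equivalence.to (IsF4⇔∈F4-elements b) b∈F4)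

plane-proper : ∀ {P} → IsPlane P → ¬ (∀ w → P w)
plane-proper {P} (u , v , w , _ , P≐) everything∈P =
  <⇒notInjective {f = code ∘ enumerate} (from-yes (64 ℕ.<? 256))
    (λ {i} {j} eq → enumerate-injective (code-injective (coordinates (enumerate i)) (coordinates (enumerate j)) eq))
  where
  open Injection (↔⇒↣ Fin256↔V) using () renaming (to to enumerate; injective to enumerate-injective)

  coordinates : ∀ x → Span3 u v w x
  coordinates x = ≐⇒⊆ P≐ x (everything∈P x)

  code-of : ∀ {x} → Span3 u v w x → Fin 64
  code-of (a , b , c , a∈F4 , b∈F4 , c∈F4 , _) = combine (F4-index a a∈F4) (combine (F4-index b b∈F4) (F4-index c c∈F4))

  code : V → Fin 64
  code x = code-of (coordinates x)

  code-injective : ∀ {x y} (p : Span3 u v w x) (q : Span3 u v w y) → code-of p ≡ code-of q → x ≡ y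
  code-injective (a , b , c , a∈ , b∈ , c∈ , refl) (a′ , b′ , c′ , a′∈ , b′∈ , c′∈ , refl) eq =
    let a-eq , bc-eq = combine-injective (F4-index a a∈) (combine (F4-index b b∈) (F4-index c c∈))
                                         (F4-index a′ a′∈) (combine (F4-index b′ b′∈) (F4-index c′ c′∈)) eq
        b-eq , c-eq = combine-injective (F4-index b b∈) (F4-index c c∈) (F4-index b′ b′∈) (F4-index c′ c′∈) bc-eq
    in cong₂ (λ a (b , c) → a · u +V b · v +V c · w) (F4-index-injective a a′ a∈ a′∈ a-eq)
             (cong₂ _,_ (F4-index-injective b b′ b∈ b′∈ b-eq) (F4-index-injective c c′ c∈ c′∈ c-eq))

subspace-⊇-s : ∀ {W z z′} → IsSubspace W → W (zeroF , z) → W (zeroF , z′) → F4-Independent z z′ → s ⊆ W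
subspace-⊇-s {W} {z} {z′} W-sub z∈W z′∈W indep (x , y) x≡0 = from-span (F4-Independent⇒span indep y)
  where
  vertical : ∀ g h → g *F zeroF +F h *F zeroF ≡ zeroF
  vertical = solve-∀ F16-ring

  from-span : (∃₂ λ g h → IsF4 g × IsF4 h × y ≡ g *F z +F h *F z′) → W (x , y)
  from-span (g , h , g∈F4 , h∈F4 , y≡) =
    subst W (cong₂ _,_ (trans (vertical g h) (sym x≡0)) (sym y≡)) (lincomb-closed W-sub g∈F4 h∈F4 z∈W z′∈W)

subspace-everything : ∀ {W w₁ w₂ z z′} → IsSubspace W → W w₁ → W w₂ → F4-Independent (proj₁ w₁) (proj₁ w₂) →
  W (zeroF , z) → W (zeroF , z′) → F4-Independent z z′ → ∀ w → W w
subspace-everything {W} {w₁} {w₂} W-sub w₁∈W w₂∈W x-indep z∈W z′∈W z-indep (x , y) =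
  from-span (F4-Independent⇒span x-indep x)
  where
  cancel-y : ∀ p y → p +F (y +F p) ≡ y
  cancel-y = solve-∀ F16-ring

  from-span : (∃₂ λ c d → IsF4 c × IsF4 d × x ≡ c *F proj₁ w₁ +F d *F proj₁ w₂) → W (x , y)
  from-span (c , d , c∈F4 , d∈F4 , x≡) =
    subst W (cong₂ _,_ (trans (+F-identityʳ (proj₁ w′)) (sym x≡)) (cancel-y (proj₂ w′) y))
      (+V-closed W-sub (lincomb-closed W-sub c∈F4 d∈F4 w₁∈W w₂∈W)
                       (subspace-⊇-s W-sub z∈W z′∈W z-indep (zeroF , y +F proj₂ w′) refl))
    where
    w′ : V
    w′ = c · w₁ +V d · w₂

plane-isSubspace : ∀ {P} → IsPlane P → IsSubspace P
plane-isSubspace (u , v , w , _ , P≐) = IsSubspace-resp-≐ (≐-sym P≐) (Span3-isSubspace u v w)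

plane-∩-s : ∀ {P w₁ w₂ z z′} → IsPlane P → P w₁ → P w₂ → F4-Independent (proj₁ w₁) (proj₁ w₂) →
  P (zeroF , z) → z ≢ zeroF → P (zeroF , z′) → ∃ λ a → IsF4 a × z′ ≡ a *F z
plane-∩-s {z = z} {z′} P-plane w₁∈P w₂∈P x-indep z∈P z≢0 z′∈P =
  decidable-stable (∃? λ a → IsF4? a ×-dec z′ ≟ a *F z) λ ∄a →
    plane-proper P-plane (subspace-everything (plane-isSubspace P-plane) w₁∈P w₂∈P x-indep z∈P z′∈P
                                              (z≢0 , λ a a∈F4 z′≡az → ∄a (a , a∈F4 , z′≡az)))

infix 4 _≟V_
_≟V_ : DecidableEquality V
_≟V_ = ≡-dec _≟_ _≟_

plane-decidable : ∀ {P} → IsPlane P → Decidable P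
plane-decidable (u , v , w , _ , P≐) x = map′ (≐⇒⊇ P≐ x) (≐⇒⊆ P≐ x)
  (∃? λ a → ∃? λ b → ∃? λ c → IsF4? a ×-dec IsF4? b ×-dec IsF4? c ×-dec x ≟V a · u +V b · v +V c · w)

-- Pencils

module Pencil {ℓ αℓ βℓ} (βℓ≢0 : βℓ ≢ zeroF) (ℓ≐ : ℓ ≐ Graph αℓ βℓ)
              {p P x₀ y₀} (u₀≢0 : Indep1 (x₀ , y₀)) (p≐ : p ≐ Span1 (x₀ , y₀))
              (P-plane : IsPlane P) (p⊆P : p ⊆ P) where

  Through : Sub → Set
  Through L = IsLine L × InO' ℓ L × p ⊆ L × L ⊆ P

  κ : F16
  κ = βℓ ^F 5

  u₀ : V
  u₀ = x₀ , y₀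

  u₀∈p : p u₀
  u₀∈p = ≐⇒⊇ p≐ u₀ (oneF , refl , cong₂ _,_ (sym (*F-identityˡ x₀)) (sym (*F-identityˡ y₀)))

  u₀∈P : P u₀
  u₀∈P = p⊆P u₀ u₀∈p

  P-sub : IsSubspace P
  P-sub = plane-isSubspace P-plane

  x₀≡0⇒no-lines : x₀ ≡ zeroF → ∀ L → ¬ Through L
  x₀≡0⇒no-lines x₀≡0 L (_ , L∈O′ , p⊆L , _) = on-graph (InO'⇒Graph ℓ≐ L∈O′)
    where
    on-graph : ¬ (∃₂ λ α β → OnHyperoval κ β × L ≐ Graph α β)
    on-graph (α , β , _ , L≐) = u₀≢0 (cong₂ _,_ x₀≡0 (begin
      y₀                  ≡⟨ ≐⇒⊆ L≐ u₀ (p⊆L u₀ u₀∈p) ⟩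
      linMap α β x₀       ≡⟨ cong (linMap α β) x₀≡0 ⟩
      linMap α β zeroF    ≡⟨ linMap-zero α β ⟩
      zeroF               ∎))
      where open ≡-Reasoning

  module OffS (x₀≢0 : x₀ ≢ zeroF) where
    open ≡-Reasoning

    X : F16
    X = x₀ ^F 4

    X≢0 : X ≢ zeroF
    X≢0 = ^4-nonzero x₀ x₀≢0

    αₚ : F16 → F16
    αₚ β = (y₀ +F β *F X) *F x₀ ⁻¹

    M : F16 → Sub
    M β = Graph (αₚ β) β

    v : F16 → V
    v β = t *F x₀ , t *F y₀ +F β *F X

    u₀∈M : ∀ β → M β u₀
    u₀∈M β = sym (begin
      linMap (αₚ β) β x₀                  ≡⟨ linMap-def (αₚ β) β x₀ ⟩
      αₚ β *F x₀ +F β *F X                ≡⟨ cong (_+F β *F X) (*F⁻¹*F-cancel (y₀ +F β *F X) x₀≢0) ⟩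
      (y₀ +F β *F X) +F β *F X            ≡⟨ add-twice y₀ (β *F X) ⟩
      y₀                                  ∎)
      where
      add-twice : ∀ y z → (y +F z) +F z ≡ y
      add-twice = solve-∀ F16-ring

    v∈M : ∀ β → M β (v β)
    v∈M β = sym (begin
      linMap (αₚ β) β (t *F x₀)                             ≡⟨ linMap-def (αₚ β) β (t *F x₀) ⟩
      αₚ β *F (t *F x₀) +F β *F (t *F x₀) ^F 4              ≡⟨ cong (λ z → αₚ β *F (t *F x₀) +F β *F z) (^F-distribʳ-*F 4 t x₀) ⟩
      αₚ β *F (t *F x₀) +F β *F (t ^F 4 *F X)               ≡⟨ cong (_+F β *F (t ^F 4 *F X)) (swap (αₚ β) t x₀) ⟩
      t *F (αₚ β *F x₀) +F β *F (t ^F 4 *F X)               ≡⟨ cong (λ z → t *F z +F β *F (t ^F 4 *F X)) (*F⁻¹*F-cancel (y₀ +F β *F X) x₀≢0) ⟩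
      t *F (y₀ +F β *F X) +F β *F (t ^F 4 *F X)             ≡⟨ t⁴≡t+1 y₀ β X ⟩
      t *F y₀ +F β *F X                                     ∎)
      where
      swap : ∀ a t x → a *F (t *F x) ≡ t *F (a *F x)
      swap = solve-∀ F16-ring
      t⁴≡t+1 : ∀ y b X → t *F (y +F b *F X) +F b *F (t ^F 4 *F X) ≡ t *F y +F b *F X
      t⁴≡t+1 = solve-∀ F16-ring

    through-u₀ : ∀ {α β} → Graph α β u₀ → α ≡ αₚ β
    through-u₀ {α} {β} y₀≡ = begin
      α                                      ≡⟨ sym (*F*F⁻¹-cancel α x₀≢0) ⟩
      α *F x₀ *F x₀ ⁻¹                       ≡⟨ cong (_*F x₀ ⁻¹) (add-twice (α *F x₀) (β *F X)) ⟩
      ((α *F x₀ +F β *F X) +F β *F X) *F x₀ ⁻¹ ≡⟨ cong (λ z → (z +F β *F X) *F x₀ ⁻¹) (sym (trans y₀≡ (linMap-def α β x₀))) ⟩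
      αₚ β                                   ∎
      where
      add-twice : ∀ y z → y ≡ (y +F z) +F z
      add-twice = solve-∀ F16-ring

    slope-F4-Independent : F4-Independent x₀ (t *F x₀)
    slope-F4-Independent = x₀≢0 , λ a a∈F4 tx₀≡ax₀ →
      proj₂ 1,t-F4-Independent a a∈F4 (trans (*F-cancelʳ x₀≢0 tx₀≡ax₀) (sym (*F-identityʳ a)))

    M⊆P : ∀ β → P (v β) → M β ⊆ P
    M⊆P β vβ∈P w w∈M =
      Span2-minimal P-sub u₀∈P vβ∈P w (≐⇒⊆ (Graph-≐-Span2 (u₀∈M β) (v∈M β) slope-F4-Independent) w w∈M)

    p⊆M : ∀ β → p ⊆ M β
    p⊆M β w w∈p = on-span (≐⇒⊆ p≐ w w∈p)
      where
      on-span : Span1 u₀ w → M β w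
      on-span (a , a∈F4 , refl) = ·-closed (Graph-isSubspace (αₚ β) β) a∈F4 (u₀∈M β)

    M-injective : ∀ {β β′} → M β ≐ M β′ → β ≡ β′
    M-injective {β} {β′} M≐M′ =
      *F-cancelʳ X≢0 (+F-cancelˡ (t *F y₀) (trans (≐⇒⊆ M≐M′ (v β) (v∈M β)) (sym (v∈M β′))))

    Through-M : ∀ {β} → OnHyperoval κ β → P (v β) → Through (M β)
    Through-M {β} on vβ∈P = Graph-isLine (αₚ β) β , Graph⇒InO' (αₚ β) β βℓ≢0 ℓ≐ on , p⊆M β , M⊆P β vβ∈P

    Through⇒M : ∀ {L} → Through L → ∃ λ β → OnHyperoval κ β × P (v β) × L ≐ M β
    Through⇒M {L} (_ , L∈O′ , p⊆L , L⊆P) = on-graph (InO'⇒Graph ℓ≐ L∈O′)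
      where
      on-graph : (∃₂ λ α β → OnHyperoval κ β × L ≐ Graph α β) → ∃ λ β → OnHyperoval κ β × P (v β) × L ≐ M β
      on-graph (α , β , on , L≐) = β , on , L⊆P (v β) (≐⇒⊇ L≐M (v β) (v∈M β)) , L≐M
        where
        L≐M : L ≐ M β
        L≐M = ≐-trans L≐ (Graph-cong (through-u₀ (≐⇒⊆ L≐ u₀ (p⊆L u₀ u₀∈p))) refl)

    module SlopeCoset (b : F16) (vb∈P : P (v b)) (z : F16) (z≢0 : z ≢ zeroF) (z∈P : P (zeroF , z)) where
      k : F16
      k = z *F X ⁻¹

      kX≡z : k *F X ≡ z
      kX≡z = *F⁻¹*F-cancel z X≢0

      k≢0 : k ≢ zeroF
      k≢0 k≡0 = z≢0 (trans (sym kX≡z) (trans (cong (_*F X) k≡0) (*F-zeroˡ X)))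

      coset⊆P : ∀ a → IsF4 a → P (v (b +F a *F k))
      coset⊆P a a∈F4 = subst P (cong₂ _,_ (x-part (t *F x₀) a) (y-part (t *F y₀) b X a k))
        (+V-closed P-sub vb∈P (subst (λ z → P (a · (zeroF , z))) (sym kX≡z) (·-closed P-sub a∈F4 z∈P)))
        where
        x-part : ∀ x a → x +F a *F zeroF ≡ x
        x-part = solve-∀ F16-ring
        y-part : ∀ T b X a k → (T +F b *F X) +F a *F (k *F X) ≡ T +F (b +F a *F k) *F X
        y-part = solve-∀ F16-ring

      P⊆coset : ∀ β → P (v β) → ∃ λ a → IsF4 a × β ≡ b +F a *F k
      P⊆coset β vβ∈P = from-multiple (plane-∩-s P-plane u₀∈P vb∈P slope-F4-Independent z∈P z≢0 difference∈P)
        where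
        difference∈P : P (zeroF , (β +F b) *F X)
        difference∈P = subst P (cong₂ _,_ (+F-same (t *F x₀)) (y-part (t *F y₀) β b X)) (+V-closed P-sub vβ∈P vb∈P)
          where
          y-part : ∀ T β b X → (T +F β *F X) +F (T +F b *F X) ≡ (β +F b) *F X
          y-part = solve-∀ F16-ring

        from-multiple : (∃ λ a → IsF4 a × (β +F b) *F X ≡ a *F z) → ∃ λ a → IsF4 a × β ≡ b +F a *F k
        from-multiple (a , a∈F4 , diff≡az) = a , a∈F4 , (begin
          β                 ≡⟨ add-twice β b ⟩
          (β +F b) +F b     ≡⟨ cong (_+F b) β+b≡ak ⟩
          a *F k +F b       ≡⟨ +F-comm (a *F k) b ⟩
          b +F a *F k       ∎)
          where
          add-twice : ∀ β b → β ≡ (β +F b) +F b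
          add-twice = solve-∀ F16-ring
          β+b≡ak : β +F b ≡ a *F k
          β+b≡ak = *F-cancelʳ X≢0 (trans diff≡az (trans (cong (a *F_) (sym kX≡z)) (sym (*F-assoc a k X))))

      OnCoset : F16 → Set
      OnCoset a = IsF4 a × OnHyperoval κ (b +F a *F k)

      in-coset : ∀ {L} → Through L → ∃ λ a → OnCoset a × L ≐ M (b +F a *F k)
      in-coset {L} L-through = on-M (Through⇒M L-through)
        where
        on-M : (∃ λ β → OnHyperoval κ β × P (v β) × L ≐ M β) → ∃ λ a → OnCoset a × L ≐ M (b +F a *F k)
        on-M (β , on , vβ∈P , L≐M) = from-coset (P⊆coset β vβ∈P)
          where
          from-coset : (∃ λ a → IsF4 a × β ≡ b +F a *F k) → ∃ λ a → OnCoset a × L ≐ M (b +F a *F k)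
          from-coset (a , a∈F4 , β≡) = a , (a∈F4 , subst (OnHyperoval κ) β≡ on) , subst (λ β → L ≐ M β) β≡ L≐M

      lines-through : ZeroOrTwo _≐_ Through
      lines-through = ZeroOrTwo-map {Q = OnCoset} (λ a → M (b +F a *F k))
        (λ {a} (a∈F4 , on) → Through-M on (coset⊆P a a∈F4))
        in-coset
        (λ {a₁} {a₂} M≐M′ → *F-cancelʳ {k} {a₁} {a₂} k≢0 (+F-cancelˡ b (M-injective M≐M′)))
        (affine-line-meets-hyperoval κ b k (proj₁ (norm-F4ˣ βℓ βℓ≢0)) (proj₂ (norm-F4ˣ βℓ βℓ≢0)) k≢0)

    lines-through-off-s : ZeroOrTwo _≐_ Through
    lines-through-off-s = by-cases (∃? λ b → plane-decidable P-plane (v b))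
      where
      by-cases : Dec (∃ λ b → P (v b)) → ZeroOrTwo _≐_ Through
      by-cases (yes (b , vb∈P)) =
        let z , z≢0 , z∈P = plane-meets-s P-plane in SlopeCoset.lines-through b vb∈P z z≢0 z∈P
      by-cases (no ∄b) = inj₁ λ L L-through →
        let β , _ , vβ∈P , _ = Through⇒M L-through in ∄b (β , vβ∈P)

  lines-through : ZeroOrTwo _≐_ Through
  lines-through = by-cases (x₀ ≟ zeroF)
    where
    by-cases : Dec (x₀ ≡ zeroF) → ZeroOrTwo _≐_ Through
    by-cases (yes x₀≡0) = inj₁ (x₀≡0⇒no-lines x₀≡0)
    by-cases (no x₀≢0)  = OffS.lines-through-off-s x₀≢0

proposition2 : ∀ ℓ → InA ℓ → IsHyperoval (InO' ℓ)
proposition2 ℓ ℓ∈A p P ((x₀ , y₀) , u₀≢0 , p≐) P-plane p⊆P =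
  let _ , _ , βℓ≢0 , ℓ≐ = InA⇒Graph ℓ∈A
  in Pencil.lines-through βℓ≢0 ℓ≐ u₀≢0 p≐ P-plane p⊆P
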